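{- Let $A,B$ be two sets of size $r$ and let $\sigma:A\to B$ be a uniformly random bijection. Let $A_1,\dots,A_k\subseteq A'\subseteq A$ and $B_1,\dots,B_k\subseteq B'\subseteq B$. Then the function $$t\mapsto P\left[\bigwedge_{i=1}^k\left[\sigma(A_i)\neq B_i\right]\;\middle|\;|\sigma(A')\setminus B'|=t\right]$$ is nondecreasing in $t$ (over those values of $t$ for which the conditioning event has nonzero probability).
   Context: $\sigma(A_i)$ denotes the image set of $A_i$ under $\sigma$. -}

module Defs where

open import Data.Nat using (ℕ; zero; suc; NonZero)
open import Data.Bool using (Bool)
open import Data.Bool.Properties using () renaming (_≟_ to _≟ᵇ_)
open import Data.Fin using (Fin)
open import Data.Fin.Properties using (all?; any?) renaming (_≟_ to _≟ᶠ_)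
open import Data.Fin.Subset using (Subset; _∈_; _─_; ∣_∣)
open import Data.Fin.Subset.Properties using (_∈?_)
open import Data.Vec using (Vec; []; _∷_; lookup; tabulate)
open import Data.Vec.Properties using (≡-dec)
open import Data.List using (List; []; _∷_; map; concatMap; filter; length)
open import Data.List.Base using (allFin)
open import Data.Product using (_×_; _,_; ∃)
open import Data.Integer using (+_)
open import Data.Rational using (ℚ; _/_)
open import Relation.Binary.PropositionalEquality using (_≡_; _≢_)
open import Relation.Nullary using (¬_; Dec; does)
open import Relation.Nullary.Decidable using (_×-dec_; ¬?; _→-dec_)

allVecs : (n r : ℕ) → List (Vec (Fin r) n)
allVecs zero    r = [] ∷ []
allVecs (suc n) r = concatMap (λ x → map (x ∷_) (allVecs n r)) (allFin r)

-- A map σ : Fin r → Fin r, represented by its table of values.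
-- It is a bijection iff it is injective (finite set of equal size).
IsBij : {r : ℕ} → Vec (Fin r) r → Set
IsBij {r} σ = (i j : Fin r) → lookup σ i ≡ lookup σ j → i ≡ j

isBij? : {r : ℕ} (σ : Vec (Fin r) r) → Dec (IsBij σ)
isBij? σ = all? (λ i → all? (λ j → (lookup σ i ≟ᶠ lookup σ j) →-dec (i ≟ᶠ j)))

-- The sample space: all bijections Fin r → Fin r (uniform measure).
bijections : (r : ℕ) → List (Vec (Fin r) r)
bijections r = filter isBij? (allVecs r r)

image : {r : ℕ} → Vec (Fin r) r → Subset r → Subset r
image σ S = tabulate (λ j → does (any? (λ i → (i ∈? S) ×-dec (lookup σ i ≟ᶠ j))))

count : (r : ℕ) → {P : Vec (Fin r) r → Set} → ((σ : Vec (Fin r) r) → Dec (P σ)) → ℕ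
count r P? = length (filter P? (bijections r))

Event : {r k : ℕ} → (Fin k → Subset r) → (Fin k → Subset r) → Vec (Fin r) r → Set
Event A B σ = ∀ i → image σ (A i) ≢ B i

event? : {r k : ℕ} (A B : Fin k → Subset r) (σ : Vec (Fin r) r) → Dec (Event A B σ)
event? A B σ = all? (λ i → ¬? (≡-dec _≟ᵇ_ (image σ (A i)) (B i)))

Cond : {r : ℕ} → Subset r → Subset r → ℕ → Vec (Fin r) r → Set
Cond A' B' t σ = ∣ image σ A' ─ B' ∣ ≡ t

cond? : {r : ℕ} (A' B' : Subset r) (t : ℕ) (σ : Vec (Fin r) r) → Dec (Cond A' B' t σ)
cond? A' B' t σ = ∣ image σ A' ─ B' ∣ Data.Nat.≟ t




condProb : {r k : ℕ} (A B : Fin k → Subset r) (A' B' : Subset r) (t : ℕ) →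
           .{{_ : NonZero (count r (cond? A' B' t))}} → ℚ
condProb {r} A B A' B' t =
  (+ count r (λ σ → event? A B σ ×-dec cond? A' B' t σ)) / count r (cond? A' B' t)

module Submission where

-- Write c t for the number of bijections σ with |σ(A') ∖ B'| = t and e t for those among them that also
-- satisfy every σ(A i) ≠ B i. Post-composing σ with the transposition of some s ∈ σ(A') ∩ B' and some
-- x ∉ σ(A') ∪ B' raises t by one. A bijection at level t admits exactly d t = (|A'| ∸ t)(r ∸ |B'| ∸ t)
-- such switches, and one at level t + 1 is reached by exactly d' (t + 1) = (|B'| ∸ (|A'| ∸ (t + 1)))(t + 1)
-- of them, so double counting gives d t · c t = d' (t + 1) · c (t + 1). A switch never creates an
-- equality σ(A i) = B i: if it holds after switching, then neither s nor x lies in σ(A i) (s is outside the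
-- new σ(A') and x outside B'), so it held before. Double counting within the event therefore gives
-- d t · e t ≤ d' (t + 1) · e (t + 1), and e t / c t is nondecreasing.

-- ℕ's _≤_ is opened only inside this module, since the final statement uses ℚ's.
module _ where

  open import Data.Bool using (Bool; true; false; not; _∧_)
  open import Data.Bool.Properties using (∧-zeroʳ; ∧-comm; ¬-not)
  open import Data.Fin using (Fin; zero; suc; punchIn; punchOut)
  open import Data.Fin.Permutation as Perm using (Permutation; _⟨$⟩ʳ_; _⟨$⟩ˡ_; permutation; inverseˡ; inverseʳ)
  open import Data.Fin.Permutation.Components using (transpose)
  open import Data.Fin.Properties using (_≟_; any?; punchInᵢ≢i; punchOut-injective; injective⇒≤)
  open import Data.Fin.Subset using (Subset; _∈_; _⊆_; _─_; ∣_∣)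
  open import Data.Fin.Subset.Properties using (_∈?_)
  open import Data.Integer as ℤ using (+≤+)
  open import Data.Integer.Properties using (pos-*)
  open import Data.List as List using (List; concatMap; tabulate; filter; length)
  open import Data.List.Properties using (map-++) renaming (map-∘ to List-map-∘)
  open import Data.Nat using (ℕ; zero; suc; _+_; _*_; _∸_; _≤_; _<_; s≤s; z≤n; z<s; NonZero; >-nonZero; >-nonZero⁻¹)
  open import Data.Nat.ListAction using () renaming (sum to sumˡ)
  open import Data.Nat.ListAction.Properties using (sum-++)
  open import Data.Nat.Properties hiding (_≟_)
  open import Data.Product using (∃; _×_; _,_; proj₁; proj₂)
  open import Data.Rational as ℚ using (_/_; fromℚᵘ)
  open import Data.Rational.Properties using (toℚᵘ-cancel-≤; toℚᵘ-fromℚᵘ)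
  open import Data.Rational.Unnormalised as ℚᵘ using (mkℚᵘ; *≤*)
  import Data.Rational.Unnormalised.Properties as ℚᵘ
  open import Data.Vec using (Vec; []; _∷_; lookup)
  import Data.Vec as Vec
  open import Data.Vec.Functional using (removeAt)
  open import Data.Vec.Properties
    using (lookup-map; lookup∘tabulate; tabulate∘lookup; tabulate-cong; []=⇒lookup; lookup⇒[]=; map-∘; map-cong; map-id)
  open import Function using (_∘_; const; _⇔_; mk⇔; Equivalence)
  open import Relation.Binary.PropositionalEquality
  open import Relation.Nullary using (Dec; does; yes; no; contradiction)
  open import Relation.Nullary.Decidable using (dec-true; _×-dec_)
  open import Algebra.Properties.Semiring.Sum +-*-semiring
    using (sum; sum-syntax; sum-cong-≗; sum-remove; sum-permute; ∑-comm; ∑-distrib-+; *-distribˡ-sum; *-distribʳ-sum)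
  open import Defs using (allVecs; IsBij; isBij?; image; count; Event; event?; cond?)
  open import Algebra.Properties.CommutativeSemigroup *-commutativeSemigroup
    using (x∙yz≈yx∙z; xy∙z≈y∙xz; x∙yz≈z∙yx; x∙yz≈y∙xz)

  sum-mono-≤ : ∀ {n} {f g : Fin n → ℕ} → (∀ i → f i ≤ g i) → sum f ≤ sum g
  sum-mono-≤ {zero}  _   = z≤n
  sum-mono-≤ {suc n} f≤g = +-mono-≤ (f≤g zero) (sum-mono-≤ (f≤g ∘ suc))

  sum-*-sum : ∀ {m n} (f : Fin m → ℕ) (g : Fin n → ℕ) →
              sum f * sum g ≡ sum (λ i → sum (λ j → f i * g j))
  sum-*-sum f g = begin
    sum f * sum g                       ≡⟨ *-distribʳ-sum (sum g) f ⟩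
    sum (λ i → f i * sum g)             ≡⟨ sum-cong-≗ (λ i → *-distribˡ-sum (f i) g) ⟩
    sum (λ i → sum (λ j → f i * g j))   ∎
    where open ≡-Reasoning

  sum-suc-at : ∀ {n} {f g : Fin n → ℕ} (x : Fin n) → f x ≡ suc (g x) →
               (∀ j → j ≢ x → f j ≡ g j) → sum f ≡ suc (sum g)
  sum-suc-at {suc n} {f} {g} x fx≡1+gx f≗g = begin
    sum f
      ≡⟨ sum-remove f ⟩
    f x + sum (removeAt f x)
      ≡⟨ cong₂ _+_ fx≡1+gx (sum-cong-≗ (λ k → f≗g (punchIn x k) (punchInᵢ≢i x k))) ⟩
    suc (g x + sum (removeAt g x))
      ≡⟨ cong suc (sum-remove g) ⟨
    suc (sum g) ∎
    where open ≡-Reasoning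

  sum-positive : ∀ {n} (f : Fin n → ℕ) → 0 < sum f → ∃ λ i → 0 < f i
  sum-positive {suc n} f 0<Σf with f zero in eq
  ... | suc _ = zero , subst (0 <_) (sym eq) z<s
  ... | zero  = let i , 0<fi = sum-positive (f ∘ suc) 0<Σf in suc i , 0<fi

  sum-ones : ∀ n → ∑[ i < n ] 1 ≡ n
  sum-ones zero    = refl
  sum-ones (suc n) = cong suc (sum-ones n)

  𝟙 : Bool → ℕ
  𝟙 true  = 1
  𝟙 false = 0

  𝟙-∧ : ∀ a b → 𝟙 (a ∧ b) ≡ 𝟙 a * 𝟙 b
  𝟙-∧ false b = refl
  𝟙-∧ true  b = sym (+-identityʳ (𝟙 b))

  𝟙-mono : ∀ {a b} → (a ≡ true → b ≡ true) → 𝟙 a ≤ 𝟙 b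
  𝟙-mono {false} _    = z≤n
  𝟙-mono {true}  a⇒b rewrite a⇒b refl = ≤-refl

  𝟙-split : ∀ a b → 𝟙 a ≡ 𝟙 (a ∧ b) + 𝟙 (a ∧ not b)
  𝟙-split false b     = refl
  𝟙-split true  false = refl
  𝟙-split true  true  = refl

  𝟙-*-cong : ∀ a {m n} → (a ≡ true → m ≡ n) → 𝟙 a * m ≡ 𝟙 a * n
  𝟙-*-cong false _   = refl
  𝟙-*-cong true  m≡n = cong (_+ 0) (m≡n refl)

  𝟙-positive : ∀ {a} → 0 < 𝟙 a → a ≡ true
  𝟙-positive {true} _ = refl

  sum-𝟙-split : ∀ {n} (u v : Fin n → Bool) →
    sum (𝟙 ∘ u) ≡ sum (λ j → 𝟙 (u j ∧ v j)) + sum (λ j → 𝟙 (u j ∧ not (v j)))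
  sum-𝟙-split u v = trans (sum-cong-≗ (λ j → 𝟙-split (u j) (v j)))
                           (∑-distrib-+ (λ j → 𝟙 (u j ∧ v j)) (λ j → 𝟙 (u j ∧ not (v j))))

  sum-𝟙-∧-sum : ∀ {m n} (p : Fin m → Bool) (q : Fin n → Bool) →
    ∑[ s < m ] ∑[ x < n ] 𝟙 (p s ∧ q x) ≡ sum (𝟙 ∘ p) * sum (𝟙 ∘ q)
  sum-𝟙-∧-sum p q =
    trans (sum-cong-≗ λ s → sum-cong-≗ λ x → 𝟙-∧ (p s) (q x)) (sym (sum-*-sum (𝟙 ∘ p) (𝟙 ∘ q)))

  ∧-intro : ∀ {a b} → a ≡ true → b ≡ true → a ∧ b ≡ true
  ∧-intro refl refl = refl

  ∧-elim : ∀ {a b} → a ∧ b ≡ true → a ≡ true × b ≡ true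
  ∧-elim {true} {true} _ = refl , refl

  does⇒ : ∀ {A : Set} (a? : Dec A) → does a? ≡ true → A
  does⇒ (yes a) _ = a

  bool-ext : ∀ {a b : Bool} → (a ≡ true → b ≡ true) → (b ≡ true → a ≡ true) → a ≡ b
  bool-ext {false} {false} _   _   = refl
  bool-ext {false} {true}  _   b⇒a = b⇒a refl
  bool-ext {true}  {false} a⇒b _   = sym (a⇒b refl)
  bool-ext {true}  {true}  _   _   = refl

  lookup-ext : ∀ {A : Set} {n} {u v : Vec A n} → (∀ i → lookup u i ≡ lookup v i) → u ≡ v
  lookup-ext {u = u} {v} u≗v =
    trans (sym (tabulate∘lookup u)) (trans (tabulate-cong u≗v) (tabulate∘lookup v))

  ∣p∣≡sum : ∀ {n} (p : Subset n) → ∣ p ∣ ≡ sum (𝟙 ∘ lookup p)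
  ∣p∣≡sum []          = refl
  ∣p∣≡sum (true  ∷ p) = cong suc (∣p∣≡sum p)
  ∣p∣≡sum (false ∷ p) = ∣p∣≡sum p

  ∣p─q∣≡sum : ∀ {n} (p q : Subset n) → ∣ p ─ q ∣ ≡ sum (λ j → 𝟙 (lookup p j ∧ not (lookup q j)))
  ∣p─q∣≡sum []          []          = refl
  ∣p─q∣≡sum (x     ∷ p) (true  ∷ q) rewrite ∧-zeroʳ x = ∣p─q∣≡sum p q
  ∣p─q∣≡sum (false ∷ p) (false ∷ q) = ∣p─q∣≡sum p q
  ∣p─q∣≡sum (true  ∷ p) (false ∷ q) = cong suc (∣p─q∣≡sum p q)

  sumVecs : ∀ n {r} → (Vec (Fin r) n → ℕ) → ℕ
  sumVecs zero    f = f []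
  sumVecs (suc n) f = sum (λ x → sumVecs n (λ v → f (x ∷ v)))

  module _ {r : ℕ} where

    sumVecs-cong : ∀ n {f g : Vec (Fin r) n → ℕ} → (∀ v → f v ≡ g v) → sumVecs n f ≡ sumVecs n g
    sumVecs-cong zero    f≗g = f≗g []
    sumVecs-cong (suc n) f≗g = sum-cong-≗ (λ x → sumVecs-cong n (λ v → f≗g (x ∷ v)))

    sumVecs-mono-≤ : ∀ n {f g : Vec (Fin r) n → ℕ} → (∀ v → f v ≤ g v) → sumVecs n f ≤ sumVecs n g
    sumVecs-mono-≤ zero    f≤g = f≤g []
    sumVecs-mono-≤ (suc n) f≤g = sum-mono-≤ (λ x → sumVecs-mono-≤ n (λ v → f≤g (x ∷ v)))

    *-distribˡ-sumVecs : ∀ n c (f : Vec (Fin r) n → ℕ) → c * sumVecs n f ≡ sumVecs n (λ v → c * f v)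
    *-distribˡ-sumVecs zero    c f = refl
    *-distribˡ-sumVecs (suc n) c f =
      trans (*-distribˡ-sum c (λ x → sumVecs n (λ v → f (x ∷ v))))
            (sum-cong-≗ (λ x → *-distribˡ-sumVecs n c (λ v → f (x ∷ v))))

    sumVecs-sum-comm : ∀ n {m} (f : Vec (Fin r) n → Fin m → ℕ) →
      sumVecs n (λ v → sum (f v)) ≡ sum (λ j → sumVecs n (λ v → f v j))
    sumVecs-sum-comm zero    f = refl
    sumVecs-sum-comm (suc n) f =
      trans (sum-cong-≗ (λ x → sumVecs-sum-comm n (λ v → f (x ∷ v))))
            (∑-comm (λ x j → sumVecs n (λ v → f (x ∷ v) j)))

    sumVecs-permute : ∀ n (π : Permutation r r) (f : Vec (Fin r) n → ℕ) →
      sumVecs n (f ∘ Vec.map (π ⟨$⟩ʳ_)) ≡ sumVecs n f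
    sumVecs-permute zero    π f = refl
    sumVecs-permute (suc n) π f =
      trans (sum-cong-≗ (λ x → sumVecs-permute n π (λ v → f ((π ⟨$⟩ʳ x) ∷ v))))
            (sym (sum-permute (λ x → sumVecs n (λ v → f (x ∷ v))) π))

    sumVecs-positive : ∀ n (f : Vec (Fin r) n → ℕ) → 0 < sumVecs n f → ∃ λ v → 0 < f v
    sumVecs-positive zero    f 0<f = [] , 0<f
    sumVecs-positive (suc n) f 0<Σf =
      let x , 0<Σfx = sum-positive _ 0<Σf
          v , 0<fxv = sumVecs-positive n (λ v → f (x ∷ v)) 0<Σfx
      in x ∷ v , 0<fxv

  sumˡ-map-concatMap-tabulate : ∀ {A B : Set} {r} (f : Fin r → A) (k : A → List B) (g : B → ℕ) →
    sumˡ (List.map g (concatMap k (tabulate f))) ≡ sum (λ i → sumˡ (List.map g (k (f i))))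
  sumˡ-map-concatMap-tabulate {r = zero}  f k g = refl
  sumˡ-map-concatMap-tabulate {r = suc r} f k g = begin
    sumˡ (List.map g (k (f zero) List.++ concatMap k (tabulate (f ∘ suc))))
      ≡⟨ cong sumˡ (map-++ g (k (f zero)) _) ⟩
    sumˡ (List.map g (k (f zero)) List.++ List.map g (concatMap k (tabulate (f ∘ suc))))
      ≡⟨ sum-++ (List.map g (k (f zero))) _ ⟩
    sumˡ (List.map g (k (f zero))) + sumˡ (List.map g (concatMap k (tabulate (f ∘ suc))))
      ≡⟨ cong (sumˡ (List.map g (k (f zero))) +_) (sumˡ-map-concatMap-tabulate (f ∘ suc) k g) ⟩
    sum (λ i → sumˡ (List.map g (k (f i)))) ∎
    where open ≡-Reasoning

  sumˡ-map-allVecs : ∀ n r (f : Vec (Fin r) n → ℕ) → sumˡ (List.map f (allVecs n r)) ≡ sumVecs n f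
  sumˡ-map-allVecs zero    r f = +-identityʳ (f [])
  sumˡ-map-allVecs (suc n) r f = begin
    sumˡ (List.map f (allVecs (suc n) r))
      ≡⟨ sumˡ-map-concatMap-tabulate (λ x → x) (λ x → List.map (x ∷_) (allVecs n r)) f ⟩
    sum (λ x → sumˡ (List.map f (List.map (x ∷_) (allVecs n r))))
      ≡⟨ sum-cong-≗ {r} (λ x → cong sumˡ (sym (List-map-∘ (allVecs n r)))) ⟩
    sum (λ x → sumˡ (List.map (λ v → f (x ∷ v)) (allVecs n r)))
      ≡⟨ sum-cong-≗ {r} (λ x → sumˡ-map-allVecs n r (λ v → f (x ∷ v))) ⟩
    sumVecs (suc n) f ∎
    where open ≡-Reasoning

  length-filter-filter : ∀ {A : Set} {P Q : A → Set} (P? : ∀ a → Dec (P a)) (Q? : ∀ a → Dec (Q a)) xs →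
    length (filter P? (filter Q? xs)) ≡ sumˡ (List.map (λ a → 𝟙 (does (Q? a) ∧ does (P? a))) xs)
  length-filter-filter P? Q? List.[] = refl
  length-filter-filter P? Q? (x List.∷ xs) with does (Q? x)
  ... | false = length-filter-filter P? Q? xs
  ... | true with does (P? x)
  ...   | false = length-filter-filter P? Q? xs
  ...   | true  = cong suc (length-filter-filter P? Q? xs)

  count≡sumVecs : ∀ r {P : Vec (Fin r) r → Set} (P? : ∀ σ → Dec (P σ)) →
    count r P? ≡ sumVecs r (λ σ → 𝟙 (does (isBij? σ) ∧ does (P? σ)))
  count≡sumVecs r P? = trans (length-filter-filter P? isBij? (allVecs r r)) (sumˡ-map-allVecs r r _)

  -- Pigeonhole: punching the missed value out of σ would inject Fin (suc r) into Fin r.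
  IsBij⇒surjective : ∀ {r} (σ : Vec (Fin r) r) → IsBij σ → ∀ j → ∃ λ i → lookup σ i ≡ j
  IsBij⇒surjective {suc r} σ σ-inj j with any? (λ i → lookup σ i ≟ j)
  ... | yes hit = hit
  ... | no miss = contradiction (injective⇒≤ f-inj) (n≮n r)
    where
    j≢σ : ∀ i → j ≢ lookup σ i
    j≢σ i j≡σi = miss (i , sym j≡σi)
    f : Fin (suc r) → Fin r
    f i = punchOut (j≢σ i)
    f-inj : ∀ {x y} → f x ≡ f y → x ≡ y
    f-inj {x} {y} fx≡fy = σ-inj x y (punchOut-injective (j≢σ x) (j≢σ y) fx≡fy)

  module _ {r : ℕ} where

    image-elim : ∀ (σ : Vec (Fin r) r) S j → lookup (image σ S) j ≡ true →
                 ∃ λ i → i ∈ S × lookup σ i ≡ j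
    image-elim σ S j j∈σS =
      does⇒ (any? (λ i → (i ∈? S) ×-dec (lookup σ i ≟ j))) (trans (sym (lookup∘tabulate _ j)) j∈σS)

    image-intro : ∀ (σ : Vec (Fin r) r) S {i} → i ∈ S → lookup (image σ S) (lookup σ i) ≡ true
    image-intro σ S {i} i∈S =
      trans (lookup∘tabulate _ (lookup σ i))
            (dec-true (any? (λ k → (k ∈? S) ×-dec (lookup σ k ≟ lookup σ i))) (i , i∈S , refl))

    image-permute : ∀ (π : Permutation r r) (σ : Vec (Fin r) r) S j →
      lookup (image (Vec.map (π ⟨$⟩ʳ_) σ) S) j ≡ lookup (image σ S) (π ⟨$⟩ˡ j)
    image-permute π σ S j = bool-ext to from
      where
      to : lookup (image (Vec.map (π ⟨$⟩ʳ_) σ) S) j ≡ true → lookup (image σ S) (π ⟨$⟩ˡ j) ≡ true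
      to j∈ with image-elim (Vec.map (π ⟨$⟩ʳ_) σ) S j j∈
      ... | i , i∈S , πσi≡j = subst (λ k → lookup (image σ S) k ≡ true)
              (trans (sym (inverseˡ π)) (cong (π ⟨$⟩ˡ_) (trans (sym (lookup-map i (π ⟨$⟩ʳ_) σ)) πσi≡j)))
              (image-intro σ S i∈S)
      from : lookup (image σ S) (π ⟨$⟩ˡ j) ≡ true → lookup (image (Vec.map (π ⟨$⟩ʳ_) σ) S) j ≡ true
      from j∈ with image-elim σ S _ j∈
      ... | i , i∈S , σi≡π⁻¹j = subst (λ k → lookup (image (Vec.map (π ⟨$⟩ʳ_) σ) S) k ≡ true)
              (trans (lookup-map i _ σ) (trans (cong (π ⟨$⟩ʳ_) σi≡π⁻¹j) (inverseʳ π)))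
              (image-intro (Vec.map (π ⟨$⟩ʳ_) σ) S i∈S)

    IsBij-permute : ∀ (π : Permutation r r) (σ : Vec (Fin r) r) → IsBij (Vec.map (π ⟨$⟩ʳ_) σ) ⇔ IsBij σ
    IsBij-permute π σ = mk⇔
      (λ πσ-inj i j σi≡σj → πσ-inj i j
        (trans (lookup-map i _ σ) (trans (cong (π ⟨$⟩ʳ_) σi≡σj) (sym (lookup-map j _ σ)))))
      (λ σ-inj i j πσi≡πσj → σ-inj i j
        (trans (sym (inverseˡ π)) (trans (cong (π ⟨$⟩ˡ_)
          (trans (sym (lookup-map i _ σ)) (trans πσi≡πσj (lookup-map j _ σ)))) (inverseˡ π))))

    toPermutation : ∀ (σ : Vec (Fin r) r) → IsBij σ → Permutation r r
    toPermutation σ σ-inj = permutation (lookup σ) (proj₁ ∘ surj) (proj₂ ∘ surj)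
                                        (λ i → σ-inj _ i (proj₂ (surj (lookup σ i))))
      where surj = IsBij⇒surjective σ σ-inj

    image-lookup : ∀ (σ : Vec (Fin r) r) S → IsBij σ → ∀ i → lookup (image σ S) (lookup σ i) ≡ lookup S i
    image-lookup σ S σ-inj i = bool-ext to (image-intro σ S ∘ lookup⇒[]= i S)
      where
      to : lookup (image σ S) (lookup σ i) ≡ true → lookup S i ≡ true
      to σi∈ with image-elim σ S (lookup σ i) σi∈
      ... | k , k∈S , σk≡σi = subst (λ l → lookup S l ≡ true) (σ-inj k i σk≡σi) ([]=⇒lookup k∈S)

    ∣image∣≡∣S∣ : ∀ (σ : Vec (Fin r) r) S → IsBij σ → ∣ image σ S ∣ ≡ ∣ S ∣
    ∣image∣≡∣S∣ σ S σ-inj = begin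
      ∣ image σ S ∣                       ≡⟨ ∣p∣≡sum (image σ S) ⟩
      sum (𝟙 ∘ lookup (image σ S))         ≡⟨ sum-permute (𝟙 ∘ lookup (image σ S)) (toPermutation σ σ-inj) ⟩
      sum (𝟙 ∘ lookup (image σ S) ∘ lookup σ) ≡⟨ sum-cong-≗ (cong 𝟙 ∘ image-lookup σ S σ-inj) ⟩
      sum (𝟙 ∘ lookup S)                   ≡⟨ ∣p∣≡sum S ⟨
      ∣ S ∣                               ∎
      where open ≡-Reasoning

  transpose-matchˡ : ∀ {n} (i j : Fin n) → transpose i j i ≡ j
  transpose-matchˡ i j with i ≟ i
  ... | yes _   = refl
  ... | no i≢i = contradiction refl i≢i

  transpose-matchʳ : ∀ {n} (i j : Fin n) → transpose i j j ≡ i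
  transpose-matchʳ i j with j ≟ i
  ... | yes j≡i = j≡i
  ... | no _ with j ≟ j
  ...   | yes _   = refl
  ...   | no j≢j = contradiction refl j≢j

  transpose-other : ∀ {n} {i j k : Fin n} → k ≢ i → k ≢ j → transpose i j k ≡ k
  transpose-other {i = i} {j} {k} k≢i k≢j with k ≟ i
  ... | yes k≡i = contradiction k≡i k≢i
  ... | no _ with k ≟ j
  ...   | yes k≡j = contradiction k≡j k≢j
  ...   | no _    = refl

  transpose-involutive : ∀ {n} (i j k : Fin n) → transpose i j (transpose i j k) ≡ k
  transpose-involutive i j k = cases (k ≟ i) (k ≟ j)
    where
    cases : Dec (k ≡ i) → Dec (k ≡ j) → transpose i j (transpose i j k) ≡ k
    cases (yes refl) _        = trans (cong (transpose k j) (transpose-matchˡ k j)) (transpose-matchʳ k j)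
    cases (no _)     (yes refl) = trans (cong (transpose i k) (transpose-matchʳ i k)) (transpose-matchˡ i k)
    cases (no k≢i)   (no k≢j) = trans (cong (transpose i j) (transpose-other k≢i k≢j)) (transpose-other k≢i k≢j)

  switch : ∀ {n r} → Fin r → Fin r → Vec (Fin r) n → Vec (Fin r) n
  switch s x = Vec.map (Perm.transpose s x ⟨$⟩ʳ_)

  switch-involutive : ∀ {n r} (s x : Fin r) (σ : Vec (Fin r) n) → switch s x (switch s x σ) ≡ σ
  switch-involutive s x σ =
    trans (sym (map-∘ _ _ σ)) (trans (map-cong (transpose-involutive s x) σ) (map-id σ))

  image-mono : ∀ {r} (σ : Vec (Fin r) r) {S T} → S ⊆ T → ∀ {j} →
    lookup (image σ S) j ≡ true → lookup (image σ T) j ≡ true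
  image-mono σ {S} {T} S⊆T {j} j∈σS with image-elim σ S j j∈σS
  ... | i , i∈S , σi≡j = subst (λ l → lookup (image σ T) l ≡ true) σi≡j (image-intro σ T (S⊆T i∈S))

  image-switch-outside : ∀ {r} (σ : Vec (Fin r) r) S {s x} →
    lookup (image σ S) s ≡ false → lookup (image σ S) x ≡ false → image (switch s x σ) S ≡ image σ S
  image-switch-outside σ S {s} {x} s∉σS x∉σS = lookup-ext (λ j →
    trans (image-permute (Perm.transpose s x) σ S j) (cases j (j ≟ s) (j ≟ x)))
    where
    σS = lookup (image σ S)
    cases : ∀ j → Dec (j ≡ s) → Dec (j ≡ x) → σS (transpose x s j) ≡ σS j
    cases j (yes refl) _          = trans (cong σS (transpose-matchʳ x j)) (trans x∉σS (sym s∉σS))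
    cases j (no _)     (yes refl) = trans (cong σS (transpose-matchˡ j s)) (trans s∉σS (sym x∉σS))
    cases j (no j≢s)   (no j≢x)   = cong σS (transpose-other j≢x j≢s)

  IsBij-switch : ∀ {r} (s x : Fin r) (σ : Vec (Fin r) r) → IsBij σ → IsBij (switch s x σ)
  IsBij-switch s x σ = Equivalence.from (IsBij-permute (Perm.transpose s x) σ)

  -- For fixed s and x, σ ↦ switch s x σ permutes the vectors, so the sum over σ can be reindexed.
  sum-switch-≤ : ∀ {n r} (F H : Vec (Fin r) n → Fin r → Fin r → ℕ) →
    (∀ σ s x → F σ s x ≤ H (switch s x σ) s x) →
    sumVecs n (λ σ → ∑[ s < r ] ∑[ x < r ] F σ s x) ≤ sumVecs n (λ σ → ∑[ s < r ] ∑[ x < r ] H σ s x)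
  sum-switch-≤ {n} {r} F H F≤H = begin
    sumVecs n (λ σ → ∑[ s < r ] ∑[ x < r ] F σ s x)
      ≡⟨ sumVecs-sum² F ⟩
    ∑[ s < r ] ∑[ x < r ] sumVecs n (λ σ → F σ s x)
      ≤⟨ sum-mono-≤ (λ s → sum-mono-≤ λ x → sumVecs-mono-≤ n (λ σ → F≤H σ s x)) ⟩
    ∑[ s < r ] ∑[ x < r ] sumVecs n (λ σ → H (switch s x σ) s x)
      ≡⟨ sum-cong-≗ (λ s → sum-cong-≗ λ x → sumVecs-permute n (Perm.transpose s x) (λ σ → H σ s x)) ⟩
    ∑[ s < r ] ∑[ x < r ] sumVecs n (λ σ → H σ s x)
      ≡⟨ sumVecs-sum² H ⟨
    sumVecs n (λ σ → ∑[ s < r ] ∑[ x < r ] H σ s x) ∎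
    where
    open ≤-Reasoning
    sumVecs-sum² : ∀ (K : Vec (Fin r) n → Fin r → Fin r → ℕ) →
      sumVecs n (λ σ → ∑[ s < r ] ∑[ x < r ] K σ s x) ≡ ∑[ s < r ] ∑[ x < r ] sumVecs n (λ σ → K σ s x)
    sumVecs-sum² K = trans (sumVecs-sum-comm n (λ σ s → sum (K σ s)))
                           (sum-cong-≗ (λ s → sumVecs-sum-comm n (λ σ → K σ s)))

  sum-regular : ∀ {n r} (w : Vec (Fin r) n → Bool) (D : Vec (Fin r) n → Fin r → Fin r → Bool) k →
    (∀ σ → w σ ≡ true → ∑[ s < r ] ∑[ x < r ] 𝟙 (D σ s x) ≡ k) →
    sumVecs n (λ σ → ∑[ s < r ] ∑[ x < r ] 𝟙 (w σ ∧ D σ s x)) ≡ k * sumVecs n (𝟙 ∘ w)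
  sum-regular {n} {r} w D k degree = trans (sumVecs-cong n pointwise) (sym (*-distribˡ-sumVecs n k (𝟙 ∘ w)))
    where
    pointwise : ∀ σ → ∑[ s < r ] ∑[ x < r ] 𝟙 (w σ ∧ D σ s x) ≡ k * 𝟙 (w σ)
    pointwise σ = begin
      ∑[ s < r ] ∑[ x < r ] 𝟙 (w σ ∧ D σ s x)
        ≡⟨ sum-cong-≗ (λ s → sum-cong-≗ λ x → 𝟙-∧ (w σ) (D σ s x)) ⟩
      ∑[ s < r ] ∑[ x < r ] (𝟙 (w σ) * 𝟙 (D σ s x))
        ≡⟨ sum-cong-≗ (λ s → *-distribˡ-sum (𝟙 (w σ)) (λ x → 𝟙 (D σ s x))) ⟨
      ∑[ s < r ] (𝟙 (w σ) * ∑[ x < r ] 𝟙 (D σ s x))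
        ≡⟨ *-distribˡ-sum (𝟙 (w σ)) (λ s → ∑[ x < r ] 𝟙 (D σ s x)) ⟨
      𝟙 (w σ) * ∑[ s < r ] ∑[ x < r ] 𝟙 (D σ s x)
        ≡⟨ 𝟙-*-cong (w σ) (degree σ) ⟩
      𝟙 (w σ) * k
        ≡⟨ *-comm (𝟙 (w σ)) k ⟩
      k * 𝟙 (w σ) ∎
      where open ≡-Reasoning

  cross-≤-trans : ∀ x y z {cx cy cz} → 0 < cy → x * cy ≤ y * cx → y * cz ≤ z * cy → x * cz ≤ z * cx
  cross-≤-trans x y z {cx} {cy} {cz} 0<cy xy yz = *-cancelˡ-≤ cy {{>-nonZero 0<cy}} (begin
    cy * (x * cz)  ≡⟨ x∙yz≈yx∙z cy x cz ⟩
    x * cy * cz    ≤⟨ *-monoˡ-≤ cz xy ⟩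
    y * cx * cz    ≡⟨ xy∙z≈y∙xz y cx cz ⟩
    cx * (y * cz)  ≤⟨ *-monoʳ-≤ cx yz ⟩
    cx * (z * cy)  ≡⟨ x∙yz≈z∙yx cx z cy ⟩
    cy * (z * cx)  ∎)
    where open ≤-Reasoning

  ratio-mono : ∀ (c e d d' : ℕ → ℕ) →
    (∀ t → d t * c t ≡ d' (suc t) * c (suc t)) →
    (∀ t → d t * e t ≤ d' (suc t) * e (suc t)) →
    (∀ {t u} → t < u → 0 < c u → 0 < d t) →
    ∀ {t u} → t ≤ u → 0 < c t → 0 < c u → e t * c u ≤ e u * c t
  ratio-mono c e d d' balance growth d-positive {t} {u} t≤u 0<ct 0<cu =
    chain (u ∸ t) t (m∸n+n≡m t≤u) 0<ct
    where
    step : ∀ t → 0 < c t → 0 < d t → e t * c (suc t) ≤ e (suc t) * c t × 0 < c (suc t)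
    step t 0<ct 0<dt = *-cancelˡ-≤ (d' (suc t)) {{m*n≢0⇒m≢0 (d' (suc t))}} cross
                     , >-nonZero⁻¹ (c (suc t)) {{m*n≢0⇒n≢0 (d' (suc t))}}
      where
      instance
        d'c⁺≢0 : NonZero (d' (suc t) * c (suc t))
        d'c⁺≢0 = >-nonZero (subst (0 <_) (balance t) (*-mono-< 0<dt 0<ct))
      cross : d' (suc t) * (e t * c (suc t)) ≤ d' (suc t) * (e (suc t) * c t)
      cross = begin
        d' (suc t) * (e t * c (suc t))   ≡⟨ x∙yz≈y∙xz (d' (suc t)) (e t) (c (suc t)) ⟩
        e t * (d' (suc t) * c (suc t))   ≡⟨ cong (e t *_) (balance t) ⟨
        e t * (d t * c t)                ≡⟨ x∙yz≈yx∙z (e t) (d t) (c t) ⟩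
        d t * e t * c t                  ≤⟨ *-monoˡ-≤ (c t) (growth t) ⟩
        d' (suc t) * e (suc t) * c t     ≡⟨ *-assoc (d' (suc t)) (e (suc t)) (c t) ⟩
        d' (suc t) * (e (suc t) * c t)   ∎
        where open ≤-Reasoning
    chain : ∀ m t → m + t ≡ u → 0 < c t → e t * c u ≤ e u * c t
    chain zero    t refl _   = ≤-refl
    chain (suc m) t m+t≡u 0<ct =
      let e-step , 0<c⁺ = step t 0<ct (d-positive (m+1+n≡u⇒n<u m+t≡u) 0<cu)
      in cross-≤-trans (e t) (e (suc t)) (e u) 0<c⁺ e-step (chain m (suc t) (trans (+-suc m t) m+t≡u) 0<c⁺)
      where
      m+1+n≡u⇒n<u : ∀ {m n} → suc m + n ≡ u → n < u
      m+1+n≡u⇒n<u {m} {n} refl = s≤s (m≤n+m n m)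

  module Switching {r : ℕ} (A' B' : Subset r) where

    X : Vec (Fin r) r → Fin r → Bool
    X σ = lookup (image σ A')

    β : Fin r → Bool
    β = lookup B'

    Q : Vec (Fin r) r → ℕ
    Q σ = ∣ image σ A' ─ B' ∣

    Fwd Bwd : Vec (Fin r) r → Fin r → Fin r → Bool
    Fwd σ s x = (X σ s ∧ β s) ∧ (not (β x) ∧ not (X σ x))
    Bwd σ s x = (β s ∧ not (X σ s)) ∧ (X σ x ∧ not (β x))

    X-switch : ∀ s x σ j → X (switch s x σ) j ≡ X σ (transpose x s j)
    X-switch s x σ = image-permute (Perm.transpose s x) σ A'

    Fwd≡Bwd∘switch : ∀ σ s x → Fwd σ s x ≡ Bwd (switch s x σ) s x
    Fwd≡Bwd∘switch σ s x
      rewrite X-switch s x σ s | X-switch s x σ x | transpose-matchʳ x s | transpose-matchˡ x s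
      = shuffle (X σ s) (β s) (β x) (X σ x)
      where
      shuffle : ∀ a b c d → (a ∧ b) ∧ (not c ∧ not d) ≡ (b ∧ not d) ∧ (a ∧ not c)
      shuffle false b     c d = sym (∧-zeroʳ (b ∧ not d))
      shuffle true  false c d = refl
      shuffle true  true  c d = ∧-comm (not c) (not d)

    Bwd≡Fwd∘switch : ∀ σ s x → Bwd σ s x ≡ Fwd (switch s x σ) s x
    Bwd≡Fwd∘switch σ s x =
      sym (trans (Fwd≡Bwd∘switch (switch s x σ) s x) (cong (λ τ → Bwd τ s x) (switch-involutive s x σ)))

    Fwd-elim : ∀ {σ s x} → Fwd σ s x ≡ true → X σ s ≡ true × β s ≡ true × β x ≡ false × X σ x ≡ false
    Fwd-elim = elim
      where
      elim : ∀ {a b c d} → (a ∧ b) ∧ (not c ∧ not d) ≡ true → a ≡ true × b ≡ true × c ≡ false × d ≡ false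
      elim {true} {true} {false} {false} _ = refl , refl , refl , refl

    Bwd-elim : ∀ {σ s x} → Bwd σ s x ≡ true → β s ≡ true × X σ s ≡ false × X σ x ≡ true × β x ≡ false
    Bwd-elim = elim
      where
      elim : ∀ {a b c d} → (a ∧ not b) ∧ (c ∧ not d) ≡ true → a ≡ true × b ≡ false × c ≡ true × d ≡ false
      elim {true} {false} {true} {false} _ = refl , refl , refl , refl

    Q≡sum : ∀ σ → Q σ ≡ sum (λ j → 𝟙 (X σ j ∧ not (β j)))
    Q≡sum σ = ∣p─q∣≡sum (image σ A') B'

    Q-switch : ∀ σ s x → Fwd σ s x ≡ true → Q (switch s x σ) ≡ suc (Q σ)
    Q-switch σ s x fwd with Fwd-elim {σ} fwd
    ... | Xs , βs , βx , Xx = begin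
      Q (switch s x σ)                                   ≡⟨ Q≡sum (switch s x σ) ⟩
      sum (λ j → 𝟙 (X (switch s x σ) j ∧ not (β j)))     ≡⟨ sum-suc-at x at-x elsewhere ⟩
      suc (sum (λ j → 𝟙 (X σ j ∧ not (β j))))            ≡⟨ cong suc (Q≡sum σ) ⟨
      suc (Q σ)                                          ∎
      where
      open ≡-Reasoning
      at-x : 𝟙 (X (switch s x σ) x ∧ not (β x)) ≡ suc (𝟙 (X σ x ∧ not (β x)))
      at-x rewrite X-switch s x σ x | transpose-matchˡ x s | Xs | βx | Xx = refl
      elsewhere : ∀ j → j ≢ x → 𝟙 (X (switch s x σ) j ∧ not (β j)) ≡ 𝟙 (X σ j ∧ not (β j))
      elsewhere j j≢x with j ≟ s
      ... | yes refl rewrite X-switch j x σ j | transpose-matchʳ x j | Xs | βs | Xx = refl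
      ... | no j≢s   rewrite X-switch s x σ j | transpose-other j≢x j≢s = refl

    a b : ℕ
    a = ∣ A' ∣
    b = ∣ B' ∣

    P U V : Vec (Fin r) r → ℕ
    P σ = sum (λ j → 𝟙 (X σ j ∧ β j))
    U σ = sum (λ j → 𝟙 (not (β j) ∧ not (X σ j)))
    V σ = sum (λ j → 𝟙 (β j ∧ not (X σ j)))

    P+Q≡a : ∀ σ → IsBij σ → P σ + Q σ ≡ a
    P+Q≡a σ σ-bij = begin
      P σ + Q σ                      ≡⟨ cong (P σ +_) (Q≡sum σ) ⟩
      P σ + sum (λ j → 𝟙 (X σ j ∧ not (β j))) ≡⟨ sum-𝟙-split (X σ) β ⟨
      sum (𝟙 ∘ X σ)                  ≡⟨ ∣p∣≡sum (image σ A') ⟨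
      ∣ image σ A' ∣                 ≡⟨ ∣image∣≡∣S∣ σ A' σ-bij ⟩
      a                              ∎
      where open ≡-Reasoning

    b+Q+U≡r : ∀ σ → b + (Q σ + U σ) ≡ r
    b+Q+U≡r σ = begin
      b + (Q σ + U σ)
        ≡⟨ cong₂ _+_ (∣p∣≡sum B') (cong (_+ U σ) (trans (Q≡sum σ) Q-summand-comm)) ⟩
      sum (𝟙 ∘ β) + (sum (λ j → 𝟙 (not (β j) ∧ X σ j)) + U σ)
        ≡⟨ cong (sum (𝟙 ∘ β) +_) (sum-𝟙-split (not ∘ β) (X σ)) ⟨
      sum (𝟙 ∘ β) + sum (𝟙 ∘ not ∘ β)
        ≡⟨ sum-𝟙-split (λ _ → true) β ⟨
      ∑[ j < r ] 1
        ≡⟨ sum-ones r ⟩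
      r ∎
      where
      open ≡-Reasoning
      Q-summand-comm : sum (λ j → 𝟙 (X σ j ∧ not (β j))) ≡ sum (λ j → 𝟙 (not (β j) ∧ X σ j))
      Q-summand-comm = sum-cong-≗ (λ j → cong 𝟙 (∧-comm (X σ j) (not (β j))))

    P+V≡b : ∀ σ → P σ + V σ ≡ b
    P+V≡b σ = begin
      P σ + V σ                       ≡⟨ cong (_+ V σ) (sum-cong-≗ (λ j → cong 𝟙 (∧-comm (X σ j) (β j)))) ⟩
      sum (λ j → 𝟙 (β j ∧ X σ j)) + V σ ≡⟨ sum-𝟙-split β (X σ) ⟨
      sum (𝟙 ∘ β)                     ≡⟨ ∣p∣≡sum B' ⟨
      b                               ∎
      where open ≡-Reasoning

    P≡a∸Q : ∀ σ → IsBij σ → P σ ≡ a ∸ Q σ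
    P≡a∸Q σ σ-bij = trans (sym (m+n∸n≡m (P σ) (Q σ))) (cong (_∸ Q σ) (P+Q≡a σ σ-bij))

    U≡r∸b∸Q : ∀ σ → U σ ≡ r ∸ b ∸ Q σ
    U≡r∸b∸Q σ = begin
      U σ                      ≡⟨ m+n∸m≡n (Q σ) (U σ) ⟨
      Q σ + U σ ∸ Q σ          ≡⟨ cong (_∸ Q σ) (m+n∸m≡n b (Q σ + U σ)) ⟨
      b + (Q σ + U σ) ∸ b ∸ Q σ ≡⟨ cong (λ n → n ∸ b ∸ Q σ) (b+Q+U≡r σ) ⟩
      r ∸ b ∸ Q σ              ∎
      where open ≡-Reasoning

    V≡b∸[a∸Q] : ∀ σ → IsBij σ → V σ ≡ b ∸ (a ∸ Q σ)
    V≡b∸[a∸Q] σ σ-bij = trans (sym (m+n∸m≡n (P σ) (V σ))) (cong₂ _∸_ (P+V≡b σ) (P≡a∸Q σ σ-bij))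

    d d' : ℕ → ℕ
    d  t = (a ∸ t) * (r ∸ b ∸ t)
    d' t = (b ∸ (a ∸ t)) * t

    #Fwd : ∀ σ → IsBij σ → ∑[ s < r ] ∑[ x < r ] 𝟙 (Fwd σ s x) ≡ d (Q σ)
    #Fwd σ σ-bij = trans (sum-𝟙-∧-sum (λ s → X σ s ∧ β s) (λ x → not (β x) ∧ not (X σ x)))
                         (cong₂ _*_ (P≡a∸Q σ σ-bij) (U≡r∸b∸Q σ))

    #Bwd : ∀ σ → IsBij σ → ∑[ s < r ] ∑[ x < r ] 𝟙 (Bwd σ s x) ≡ d' (Q σ)
    #Bwd σ σ-bij = trans (sum-𝟙-∧-sum (λ s → β s ∧ not (X σ s)) (λ x → X σ x ∧ not (β x)))
                         (cong₂ _*_ (V≡b∸[a∸Q] σ σ-bij) (sym (Q≡sum σ)))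

    inClass : (Vec (Fin r) r → Bool) → ℕ → Vec (Fin r) r → Bool
    inClass G t σ = does (isBij? σ) ∧ (G σ ∧ does (cond? A' B' t σ))

    N : (Vec (Fin r) r → Bool) → ℕ → ℕ
    N G t = sumVecs r (𝟙 ∘ inClass G t)

    inClass-elim : ∀ G t σ → inClass G t σ ≡ true → IsBij σ × G σ ≡ true × Q σ ≡ t
    inClass-elim G t σ in-class =
      let bij , rest = ∧-elim {does (isBij? σ)} in-class
          g , c = ∧-elim {G σ} rest
      in does⇒ (isBij? σ) bij , g , does⇒ (cond? A' B' t σ) c

    inClass-intro : ∀ G t σ → IsBij σ → G σ ≡ true → Q σ ≡ t → inClass G t σ ≡ true
    inClass-intro G t σ bij g c =
      ∧-intro (dec-true (isBij? σ) bij) (∧-intro g (dec-true (cond? A' B' t σ) c))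

    #Fwd-inClass : ∀ G t σ → inClass G t σ ≡ true → ∑[ s < r ] ∑[ x < r ] 𝟙 (Fwd σ s x) ≡ d t
    #Fwd-inClass G t σ in-class = let bij , _ , q = inClass-elim G t σ in-class in trans (#Fwd σ bij) (cong d q)

    #Bwd-inClass : ∀ G t σ → inClass G t σ ≡ true → ∑[ s < r ] ∑[ x < r ] 𝟙 (Bwd σ s x) ≡ d' t
    #Bwd-inClass G t σ in-class = let bij , _ , q = inClass-elim G t σ in-class in trans (#Bwd σ bij) (cong d' q)

    Q-switch⁻¹ : ∀ σ s x → Bwd σ s x ≡ true → Q σ ≡ suc (Q (switch s x σ))
    Q-switch⁻¹ σ s x bwd = trans (cong Q (sym (switch-involutive s x σ)))
      (Q-switch (switch s x σ) s x (trans (sym (Bwd≡Fwd∘switch σ s x)) bwd))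

    Fwd-switch : ∀ G → (∀ σ s x → Fwd σ s x ≡ true → G σ ≡ true → G (switch s x σ) ≡ true) →
      ∀ t σ s x → inClass G t σ ∧ Fwd σ s x ≡ true →
      inClass G (suc t) (switch s x σ) ∧ Bwd (switch s x σ) s x ≡ true
    Fwd-switch G G-stable t σ s x both =
      let in-class , fwd = ∧-elim {inClass G t σ} both
          bij , g , q = inClass-elim G t σ in-class
      in ∧-intro (inClass-intro G (suc t) (switch s x σ) (IsBij-switch s x σ bij) (G-stable σ s x fwd g)
                                (trans (Q-switch σ s x fwd) (cong suc q)))
                 (trans (sym (Fwd≡Bwd∘switch σ s x)) fwd)

    Bwd-switch : ∀ G → (∀ σ s x → Bwd σ s x ≡ true → G σ ≡ true → G (switch s x σ) ≡ true) →
      ∀ t σ s x → inClass G (suc t) σ ∧ Bwd σ s x ≡ true →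
      inClass G t (switch s x σ) ∧ Fwd (switch s x σ) s x ≡ true
    Bwd-switch G G-stable t σ s x both =
      let in-class , bwd = ∧-elim {inClass G (suc t) σ} both
          bij , g , q = inClass-elim G (suc t) σ in-class
      in ∧-intro (inClass-intro G t (switch s x σ) (IsBij-switch s x σ bij) (G-stable σ s x bwd g)
                                (suc-injective (trans (sym (Q-switch⁻¹ σ s x bwd)) q)))
                 (trans (sym (Bwd≡Fwd∘switch σ s x)) bwd)

    forward-step : ∀ G → (∀ σ s x → Fwd σ s x ≡ true → G σ ≡ true → G (switch s x σ) ≡ true) →
      ∀ t → d t * N G t ≤ d' (suc t) * N G (suc t)
    forward-step G G-stable t = begin
      d t * N G t
        ≡⟨ sum-regular (inClass G t) Fwd (d t) (#Fwd-inClass G t) ⟨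
      sumVecs r (λ σ → ∑[ s < r ] ∑[ x < r ] 𝟙 (inClass G t σ ∧ Fwd σ s x))
        ≤⟨ sum-switch-≤ _ _ (λ σ s x → 𝟙-mono (Fwd-switch G G-stable t σ s x)) ⟩
      sumVecs r (λ σ → ∑[ s < r ] ∑[ x < r ] 𝟙 (inClass G (suc t) σ ∧ Bwd σ s x))
        ≡⟨ sum-regular (inClass G (suc t)) Bwd (d' (suc t)) (#Bwd-inClass G (suc t)) ⟩
      d' (suc t) * N G (suc t) ∎
      where open ≤-Reasoning

    backward-step : ∀ G → (∀ σ s x → Bwd σ s x ≡ true → G σ ≡ true → G (switch s x σ) ≡ true) →
      ∀ t → d' (suc t) * N G (suc t) ≤ d t * N G t
    backward-step G G-stable t = begin
      d' (suc t) * N G (suc t)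
        ≡⟨ sum-regular (inClass G (suc t)) Bwd (d' (suc t)) (#Bwd-inClass G (suc t)) ⟨
      sumVecs r (λ σ → ∑[ s < r ] ∑[ x < r ] 𝟙 (inClass G (suc t) σ ∧ Bwd σ s x))
        ≤⟨ sum-switch-≤ _ _ (λ σ s x → 𝟙-mono (Bwd-switch G G-stable t σ s x)) ⟩
      sumVecs r (λ σ → ∑[ s < r ] ∑[ x < r ] 𝟙 (inClass G t σ ∧ Fwd σ s x))
        ≡⟨ sum-regular (inClass G t) Fwd (d t) (#Fwd-inClass G t) ⟩
      d t * N G t ∎
      where open ≤-Reasoning

    N-balance : ∀ t → d t * N (const true) t ≡ d' (suc t) * N (const true) (suc t)
    N-balance t = ≤-antisym (forward-step (const true) (λ _ _ _ _ _ → refl) t)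
                            (backward-step (const true) (λ _ _ _ _ _ → refl) t)

    d-positive : ∀ G {t u} → t < u → 0 < N G u → 0 < d t
    d-positive G {t} {u} t<u 0<N with sumVecs-positive r (𝟙 ∘ inClass G u) 0<N
    ... | σ , 0<𝟙 with inClass-elim G u σ (𝟙-positive 0<𝟙)
    ... | bij , _ , refl = *-mono-< (m<n⇒0<n∸m (<-≤-trans t<u Q≤a)) (m<n⇒0<n∸m (<-≤-trans t<u Q≤r∸b))
      where
      Q≤a : Q σ ≤ a
      Q≤a = subst (Q σ ≤_) (P+Q≡a σ bij) (m≤n+m (Q σ) (P σ))
      Q≤r∸b : Q σ ≤ r ∸ b
      Q≤r∸b = subst (Q σ ≤_) (trans (sym (m+n∸m≡n b (Q σ + U σ))) (cong (_∸ b) (b+Q+U≡r σ)))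
                    (m≤m+n (Q σ) (U σ))

    Event-switch : ∀ {k} (A B : Fin k → Subset r) → (∀ i → A i ⊆ A') → (∀ i → B i ⊆ B') →
      ∀ σ s x → Fwd σ s x ≡ true → Event A B σ → Event A B (switch s x σ)
    Event-switch A B A⊆A' B⊆B' σ s x fwd event i σ'Ai≡Bi
      with Bwd-elim {switch s x σ} (trans (sym (Fwd≡Bwd∘switch σ s x)) fwd)
    ... | _ , s∉σ'A' , _ , x∉B' = event i (begin
      image σ (A i)                ≡⟨ cong (λ τ → image τ (A i)) (switch-involutive s x σ) ⟨
      image (switch s x σ') (A i)  ≡⟨ image-switch-outside σ' (A i) s∉σ'Ai x∉σ'Ai ⟩
      image σ' (A i)               ≡⟨ σ'Ai≡Bi ⟩
      B i                          ∎)
      where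
      open ≡-Reasoning
      σ' = switch s x σ
      true≢false : true ≢ false
      true≢false ()
      s∉σ'Ai : lookup (image σ' (A i)) s ≡ false
      s∉σ'Ai = ¬-not (λ s∈ → true≢false (trans (sym (image-mono σ' (A⊆A' i) s∈)) s∉σ'A'))
      x∉σ'Ai : lookup (image σ' (A i)) x ≡ false
      x∉σ'Ai = ¬-not (λ x∈ → true≢false (trans (sym ([]=⇒lookup (B⊆B' i (lookup⇒[]= x (B i)
                 (trans (cong (λ v → lookup v x) (sym σ'Ai≡Bi)) x∈))))) x∉B'))

    count-cond≡N : ∀ t → count r (cond? A' B' t) ≡ N (const true) t
    count-cond≡N t = count≡sumVecs r (cond? A' B' t)

    count-event≡N : ∀ {k} (A B : Fin k → Subset r) t →
      count r (λ σ → event? A B σ ×-dec cond? A' B' t σ) ≡ N (does ∘ event? A B) t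
    count-event≡N A B t = count≡sumVecs r (λ σ → event? A B σ ×-dec cond? A' B' t σ)

    count-ratio-mono : ∀ {k} (A B : Fin k → Subset r) → (∀ i → A i ⊆ A') → (∀ i → B i ⊆ B') →
      ∀ {t u} → t ≤ u → 0 < count r (cond? A' B' t) → 0 < count r (cond? A' B' u) →
      count r (λ σ → event? A B σ ×-dec cond? A' B' t σ) * count r (cond? A' B' u) ≤
      count r (λ σ → event? A B σ ×-dec cond? A' B' u σ) * count r (cond? A' B' t)
    count-ratio-mono A B A⊆A' B⊆B' {t} {u} t≤u
      rewrite count-cond≡N t | count-cond≡N u | count-event≡N A B t | count-event≡N A B u
      = ratio-mono (N (const true)) (N (does ∘ event? A B)) d d' N-balance growth (d-positive (const true)) t≤u
      where
      growth : ∀ t → d t * N (does ∘ event? A B) t ≤ d' (suc t) * N (does ∘ event? A B) (suc t)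
      growth = forward-step (does ∘ event? A B) (λ σ s x fwd occ → dec-true (event? A B (switch s x σ))
        (Event-switch A B A⊆A' B⊆B' σ s x fwd (does⇒ (event? A B σ) occ)))

  fromℚᵘ-mono-≤ : ∀ {p q} → p ℚᵘ.≤ q → fromℚᵘ p ℚ.≤ fromℚᵘ q
  fromℚᵘ-mono-≤ {p} {q} p≤q = toℚᵘ-cancel-≤
    (ℚᵘ.≤-respˡ-≃ (ℚᵘ.≃-sym (toℚᵘ-fromℚᵘ p)) (ℚᵘ.≤-respʳ-≃ (ℚᵘ.≃-sym (toℚᵘ-fromℚᵘ q)) p≤q))

  /-mono-cross : ∀ e c e' c' .{{_ : NonZero c}} .{{_ : NonZero c'}} → e * c' ≤ e' * c → ℤ.+ e / c ℚ.≤ ℤ.+ e' / c'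
  /-mono-cross e (suc c) e' (suc c') le =
    fromℚᵘ-mono-≤ {mkℚᵘ (ℤ.+ e) c} {mkℚᵘ (ℤ.+ e') c'}
      (*≤* (subst₂ ℤ._≤_ (pos-* e (suc c')) (pos-* e' (suc c)) (+≤+ le)))

open import Defs
open import Data.Nat using (ℕ; NonZero) renaming (_≤_ to _≤ℕ_)
open import Data.Fin using (Fin)
open import Data.Fin.Subset using (Subset; _⊆_)
open import Data.Rational using (_≤_)
open import Data.Nat using (>-nonZero⁻¹)
open import Relation.Nullary.Decidable using (_×-dec_)

mainTheorem4 : (r k : ℕ) (A B : Fin k → Subset r) (A' B' : Subset r) →
    (∀ i → A i ⊆ A') → (∀ i → B i ⊆ B') →
    (t t' : ℕ) → t ≤ℕ t' →
    (nz : NonZero (count r (cond? A' B' t))) →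
    (nz' : NonZero (count r (cond? A' B' t'))) →
    condProb A B A' B' t {{nz}} ≤ condProb A B A' B' t' {{nz'}}
mainTheorem4 r k A B A' B' A⊆A' B⊆B' t t' t≤t' nz nz' =
  /-mono-cross (count r (λ σ → event? A B σ ×-dec cond? A' B' t σ)) (count r (cond? A' B' t))
               (count r (λ σ → event? A B σ ×-dec cond? A' B' t' σ)) (count r (cond? A' B' t'))
               {{nz}} {{nz'}}
    (Switching.count-ratio-mono A' B' A B A⊆A' B⊆B' t≤t' (>-nonZero⁻¹ _ {{nz}}) (>-nonZero⁻¹ _ {{nz'}}))
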